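{- There are infinitely many positive integers $N$ such that there is exactly one pair $(A, B)$ of antipalindromic numbers with $N = A/B$.
   Context: A positive integer is antipalindromic if its base-$2$ representation (without leading zeros) $w_1 \cdots w_{2m}$ has even length and satisfies $w_i + w_{2m+1-i} = 1$ for all $i$ (the second half is the reverse complement of the first half). -}

module Defs where

open import Data.Nat using (ℕ; zero; suc; _+_; _*_; _∸_; _<_; _≤_)
open import Data.Nat.DivMod using (_/_; _%_)
open import Data.List using (List; []; _∷_; length; reverse; lookup)
open import Data.Fin using (Fin; toℕ; fromℕ<)
open import Data.Product using (Σ; ∃; _×_; _,_)
open import Relation.Binary.PropositionalEquality using (_≡_)

-- Little-endian binary digits of n (least significant first), computed with
-- fuel; fuel ≥ n suffices, and each step halves n.  binLE 0 = [] (no digits).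
binLE-fuel : ℕ → ℕ → List ℕ
binLE-fuel zero    n       = []
binLE-fuel (suc f) zero    = []
binLE-fuel (suc f) (suc n) = (suc n % 2) ∷ binLE-fuel f (suc n / 2)

-- Base-2 representation without leading zeros, most significant digit first:
-- w₁ ⋯ w_L.
bin : ℕ → List ℕ
bin n = reverse (binLE-fuel n n)

-- A positive integer n is antipalindromic if its base-2 representation
-- w₁ ⋯ w_{2m} has even length and w_i + w_{2m+1-i} = 1 for all i.
-- With 0-based indices j = i - 1 this reads w[j] + w[2m-1-j] = 1.
Antipalindromic : ℕ → Set
Antipalindromic n =
  (0 < n) ×
  (Σ ℕ λ m → (length (bin n) ≡ m + m) ×
     ((j : Fin (length (bin n))) → (j<L : (length (bin n) ∸ 1 ∸ toℕ j) < length (bin n)) →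
        lookup (bin n) j + lookup (bin n) (fromℕ< j<L) ≡ 1))

module Submission where

-- Take N = (4^(s+1) − 1)/3 with s ≥ 1, so that 3N + 1 = 4R for R = 4^s and N ≡ 5 (mod 8).
-- Then A = 2N, written (10)^(s+1) in base 2, and B = 2, written 10, form a pair.  Conversely,
-- in an antipalindromic X of length p + 3 ≥ 4 the three leading digits are the reversed
-- complement of the three trailing ones, so X ∈ [c·2^p, (c+1)·2^p) where c ∈ {4,…,7} is a
-- function of X mod 8.  Antipalindromic numbers are even, so if A = N B with B > 2 then
-- A ≡ 5B ≡ B (mod 8) and A, B share the same c.  As lengths are even, 2^p_A and R·2^p_B are
-- either equal, forcing 4R/5 < N < 5R/4, or differ by a factor of at least 4, forcing
-- N > 16R/5 or N < 5R/16.  All of these contradict 5R/4 ≤ N < 4R/3.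

open import Defs
open import Data.Nat
open import Data.Nat.Properties
open import Data.Nat.DivMod
open import Data.Nat.Divisibility using (divides-refl)
open import Data.Nat.Tactic.RingSolver using (solve-∀)
open import Data.List using (List; []; _∷_; length; reverse; lookup; _++_; _∷ʳ_; drop)
open import Data.List.Properties using (length-reverse; unfold-reverse; reverse-involutive; length-drop)
open import Data.List.Relation.Unary.All using (All; []; _∷_)
open import Data.Fin using (Fin; toℕ; fromℕ<)
open import Data.Fin.Properties using (toℕ-fromℕ<; toℕ<n)
open import Data.Product using (Σ; ∃-syntax; _×_; _,_; proj₁; proj₂)
open import Data.Sum using (_⊎_; inj₁; inj₂)
open import Data.Empty using (⊥; ⊥-elim)
open import Relation.Binary using (tri<; tri≈; tri>)
open import Relation.Binary.PropositionalEquality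

-- Indexing with the junk value 0 past the end of the list.
at : List ℕ → ℕ → ℕ
at []       _       = 0
at (x ∷ xs) zero    = x
at (x ∷ xs) (suc i) = at xs i

lookup≡at : ∀ l (i : Fin (length l)) → lookup l i ≡ at l (toℕ i)
lookup≡at (x ∷ l) Fin.zero    = refl
lookup≡at (x ∷ l) (Fin.suc i) = lookup≡at l i

at-++ˡ : ∀ xs ys {i} → i < length xs → at (xs ++ ys) i ≡ at xs i
at-++ˡ (x ∷ xs) ys {zero}  _         = refl
at-++ˡ (x ∷ xs) ys {suc i} (s≤s i<n) = at-++ˡ xs ys i<n

at-∷ʳ : ∀ xs y → at (xs ∷ʳ y) (length xs) ≡ y
at-∷ʳ []       y = refl
at-∷ʳ (x ∷ xs) y = at-∷ʳ xs y

at-drop : ∀ p ds i → at (drop p ds) i ≡ at ds (i + p)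
at-drop zero    ds       i = cong (at ds) (sym (+-identityʳ i))
at-drop (suc p) []       i = refl
at-drop (suc p) (x ∷ ds) i = trans (at-drop p ds i) (cong (at (x ∷ ds)) (sym (+-suc i p)))

mirror< : ∀ {n i} → i < n → n ∸ 1 ∸ i < n
mirror< {suc n} {i} _ = s≤s (m∸n≤m n i)

mirror-involutive : ∀ {n i} → i < n → n ∸ 1 ∸ (n ∸ 1 ∸ i) ≡ i
mirror-involutive {suc n} (s≤s i≤n) = m∸[m∸n]≡n i≤n

∸≡suc-mirror : ∀ {n i} → i < n → n ∸ i ≡ suc (n ∸ 1 ∸ i)
∸≡suc-mirror {suc n} (s≤s i≤n) = +-∸-assoc 1 i≤n

at-reverse : ∀ l {i} → i < length l → at (reverse l) i ≡ at l (length l ∸ 1 ∸ i)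
at-reverse (x ∷ l) {i} i<1+n rewrite unfold-reverse x l with m≤n⇒m<n∨m≡n (s≤s⁻¹ i<1+n)
... | inj₁ i<n = begin
    at (reverse l ∷ʳ x) i      ≡⟨ at-++ˡ (reverse l) _ (subst (i <_) (sym (length-reverse l)) i<n) ⟩
    at (reverse l) i           ≡⟨ at-reverse l i<n ⟩
    at l (length l ∸ 1 ∸ i)    ≡⟨ cong (at (x ∷ l)) (sym (∸≡suc-mirror i<n)) ⟩
    at (x ∷ l) (length l ∸ i)  ∎
  where open ≡-Reasoning
... | inj₂ refl = begin
    at (reverse l ∷ʳ x) (length l)            ≡⟨ cong (at (reverse l ∷ʳ x)) (sym (length-reverse l)) ⟩
    at (reverse l ∷ʳ x) (length (reverse l))  ≡⟨ at-∷ʳ (reverse l) x ⟩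
    x                                         ≡⟨ cong (at (x ∷ l)) (sym (n∸n≡0 (length l))) ⟩
    at (x ∷ l) (length l ∸ length l)          ∎
  where open ≡-Reasoning

Antipalindrome : List ℕ → Set
Antipalindrome l = ∀ i → i < length l → at l i + at l (length l ∸ 1 ∸ i) ≡ 1

reverse-Antipalindrome : ∀ l → Antipalindrome l → Antipalindrome (reverse l)
reverse-Antipalindrome l h i i<L′ = begin
    at (reverse l) i + at (reverse l) (length (reverse l) ∸ 1 ∸ i)
      ≡⟨ cong (λ n → at (reverse l) i + at (reverse l) (n ∸ 1 ∸ i)) (length-reverse l) ⟩
    at (reverse l) i + at (reverse l) j
      ≡⟨ cong₂ _+_ (at-reverse l i<L) (at-reverse l (mirror< i<L)) ⟩
    at l j + at l (length l ∸ 1 ∸ j)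
      ≡⟨ cong (λ k → at l j + at l k) (mirror-involutive i<L) ⟩
    at l j + at l i
      ≡⟨ +-comm (at l j) (at l i) ⟩
    at l i + at l j
      ≡⟨ h i i<L ⟩
    1 ∎
  where
  open ≡-Reasoning
  i<L = subst (i <_) (length-reverse l) i<L′
  j = length l ∸ 1 ∸ i

lookup-pair≡at-pair : ∀ l (j : Fin (length l)) (q : length l ∸ 1 ∸ toℕ j < length l) →
  lookup l j + lookup l (fromℕ< q) ≡ at l (toℕ j) + at l (length l ∸ 1 ∸ toℕ j)
lookup-pair≡at-pair l j q =
  cong₂ _+_ (lookup≡at l j) (trans (lookup≡at l (fromℕ< q)) (cong (at l) (toℕ-fromℕ< q)))

bits : ℕ → List ℕ
bits n = binLE-fuel n n

Antipalindromic⇒Antipalindrome : ∀ {X} → Antipalindromic X → Antipalindrome (bits X)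
Antipalindromic⇒Antipalindrome {X} (_ , _ , _ , h) =
  subst Antipalindrome (reverse-involutive (bits X)) (reverse-Antipalindrome (bin X) h′)
  where
  h′ : Antipalindrome (bin X)
  h′ i i<L = subst (λ k → at (bin X) k + at (bin X) (length (bin X) ∸ 1 ∸ k) ≡ 1) (toℕ-fromℕ< i<L)
    (trans (sym (lookup-pair≡at-pair (bin X) j q)) (h j q))
    where
    j = fromℕ< i<L
    q = mirror< (toℕ<n j)

Antipalindrome⇒Antipalindromic : ∀ {X m} → 0 < X → length (bits X) ≡ m + m →
  Antipalindrome (bits X) → Antipalindromic X
Antipalindrome⇒Antipalindromic {X} {m} 0<X len h =
  0<X , m , trans (length-reverse (bits X)) len ,
  λ j q → trans (lookup-pair≡at-pair (bin X) j q) (reverse-Antipalindrome (bits X) h (toℕ j) (toℕ<n j))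

eval : List ℕ → ℕ
eval []       = 0
eval (d ∷ ds) = d + 2 * eval ds

[1+n]/2≤n : ∀ n → suc n / 2 ≤ n
[1+n]/2≤n n = s≤s⁻¹ (m/n<m (suc n) 2 (s≤s (s≤s z≤n)))

eval-binLE : ∀ {f n} → n ≤ f → eval (binLE-fuel f n) ≡ n
eval-binLE {zero}  {zero}  _         = refl
eval-binLE {suc f} {zero}  _         = refl
eval-binLE {suc f} {suc n} (s≤s n≤f) = begin
    suc n % 2 + 2 * eval (binLE-fuel f (suc n / 2))
      ≡⟨ cong (λ e → suc n % 2 + 2 * e) (eval-binLE (≤-trans ([1+n]/2≤n n) n≤f)) ⟩
    suc n % 2 + 2 * (suc n / 2)  ≡⟨ cong (suc n % 2 +_) (*-comm 2 (suc n / 2)) ⟩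
    suc n % 2 + suc n / 2 * 2    ≡⟨ sym (m≡m%n+[m/n]*n (suc n) 2) ⟩
    suc n                        ∎
  where open ≡-Reasoning

binLE-digits : ∀ f n → All (_≤ 1) (binLE-fuel f n)
binLE-digits zero    n       = []
binLE-digits (suc f) zero    = []
binLE-digits (suc f) (suc n) = s≤s⁻¹ (m%n<n (suc n) 2) ∷ binLE-digits f (suc n / 2)

binLE-0 : ∀ f → binLE-fuel f 0 ≡ []
binLE-0 zero    = refl
binLE-0 (suc f) = refl

2^length-binLE≤ : ∀ {f n} → 0 < n → n ≤ f → 2 ^ length (binLE-fuel f n) ≤ 2 * n
2^length-binLE≤ {suc f} {suc n} _ (s≤s n≤f) with suc n / 2 in half
... | zero rewrite binLE-0 f = *-monoʳ-≤ 2 (s≤s z≤n)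
... | suc h = begin
    2 * 2 ^ length (binLE-fuel f (suc h))
      ≤⟨ *-monoʳ-≤ 2 (2^length-binLE≤ z<s (≤-trans (≤-reflexive (sym half)) (≤-trans ([1+n]/2≤n n) n≤f))) ⟩
    2 * (2 * suc h)          ≡⟨ cong (λ x → 2 * (2 * x)) (sym half) ⟩
    2 * (2 * (suc n / 2))    ≡⟨ cong (2 *_) (*-comm 2 (suc n / 2)) ⟩
    2 * (suc n / 2 * 2)      ≤⟨ *-monoʳ-≤ 2 (m/n*n≤m (suc n) 2) ⟩
    2 * suc n                ∎
  where open ≤-Reasoning

eval<2^length : ∀ {ds} → All (_≤ 1) ds → eval ds < 2 ^ length ds
eval<2^length []                   = s≤s z≤n
eval<2^length {d ∷ ds} (d≤1 ∷ ds≤1) = begin-strict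
    d + 2 * eval ds   <⟨ s≤s (+-monoˡ-≤ (2 * eval ds) d≤1) ⟩
    2 + 2 * eval ds   ≡⟨ sym (*-distribˡ-+ 2 1 (eval ds)) ⟩
    2 * suc (eval ds) ≤⟨ *-monoʳ-≤ 2 (eval<2^length ds≤1) ⟩
    2 * 2 ^ length ds ∎
  where open ≤-Reasoning

eval-split : ∀ p ds → All (_≤ 1) ds → ∃[ r ] r < 2 ^ p × eval ds ≡ r + 2 ^ p * eval (drop p ds)
eval-split zero    ds       _ = 0 , z<s , sym (+-identityʳ (eval ds))
eval-split (suc p) []       _ = 0 , m^n>0 2 (suc p) , sym (*-zeroʳ (2 ^ suc p))
eval-split (suc p) (d ∷ ds) (d≤1 ∷ ds≤1) with eval-split p ds ds≤1
... | r , r<2^p , eval≡ =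
  d + 2 * r , upper , trans (cong (λ e → d + 2 * e) eval≡) (regroup d r (2 ^ p) _)
  where
  regroup : ∀ d r P E → d + 2 * (r + P * E) ≡ d + 2 * r + 2 * P * E
  regroup = solve-∀
  upper : d + 2 * r < 2 ^ suc p
  upper = begin-strict
    d + 2 * r   <⟨ s≤s (+-monoˡ-≤ (2 * r) d≤1) ⟩
    2 + 2 * r   ≡⟨ sym (*-distribˡ-+ 2 1 r) ⟩
    2 * suc r   ≤⟨ *-monoʳ-≤ 2 r<2^p ⟩
    2 * 2 ^ p   ∎
    where open ≤-Reasoning

eval-low3 : ∀ ds → eval ds ≡ at ds 0 + 2 * (at ds 1 + 2 * (at ds 2 + 2 * eval (drop 3 ds)))
eval-low3 []               = refl
eval-low3 (a ∷ [])         = refl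
eval-low3 (a ∷ b ∷ [])     = refl
eval-low3 (a ∷ b ∷ c ∷ ds) = refl

eval3 : ℕ → ℕ → ℕ → ℕ
eval3 a b c = a + 2 * (b + 2 * c)

eval3<8 : ∀ {a b c} → a ≤ 1 → b ≤ 1 → c ≤ 1 → eval3 a b c < 8
eval3<8 a≤1 b≤1 c≤1 = s≤s (+-mono-≤ a≤1 (*-monoʳ-≤ 2 (+-mono-≤ b≤1 (*-monoʳ-≤ 2 c≤1))))

-- The value of the three leading digits of an antipalindrome whose three trailing
-- digits have value v: the reversed complement of v.
leading : ℕ → ℕ
leading 0 = 7
leading 1 = 3
leading 2 = 5
leading 3 = 1
leading 4 = 6
leading 5 = 2
leading 6 = 4
leading 7 = 0
leading _ = 0

leading-eval3 : ∀ {a b c} → a ≤ 1 → b ≤ 1 → c ≤ 1 →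
  leading (eval3 a b c) ≡ eval3 (1 ∸ c) (1 ∸ b) (1 ∸ a)
leading-eval3 z≤n       z≤n       z≤n       = refl
leading-eval3 z≤n       z≤n       (s≤s z≤n) = refl
leading-eval3 z≤n       (s≤s z≤n) z≤n       = refl
leading-eval3 z≤n       (s≤s z≤n) (s≤s z≤n) = refl
leading-eval3 (s≤s z≤n) z≤n       z≤n       = refl
leading-eval3 (s≤s z≤n) z≤n       (s≤s z≤n) = refl
leading-eval3 (s≤s z≤n) (s≤s z≤n) z≤n       = refl
leading-eval3 (s≤s z≤n) (s≤s z≤n) (s≤s z≤n) = refl

-- Only even residues have a leading value ≥ 4, and 5 v ≡ v (mod 8) for even v.
leading-5* : ∀ v → 4 ≤ leading v → leading (5 * v % 8) ≡ leading v
leading-5* 0 _ = refl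
leading-5* 1 (s≤s (s≤s (s≤s ())))
leading-5* 2 _ = refl
leading-5* 3 (s≤s ())
leading-5* 4 _ = refl
leading-5* 5 (s≤s (s≤s ()))
leading-5* 6 _ = refl
leading-5* 7 ()
leading-5* (suc (suc (suc (suc (suc (suc (suc (suc _)))))))) ()

at≤1 : ∀ {ds} i → All (_≤ 1) ds → at ds i ≤ 1
at≤1 _       []         = z≤n
at≤1 zero    (d≤1 ∷ _)  = d≤1
at≤1 (suc i) (_ ∷ ds≤1) = at≤1 i ds≤1

Antipalindrome-at : ∀ {ds} → All (_≤ 1) ds → Antipalindrome ds →
  ∀ {i j} → length ds ≡ suc (i + j) → 1 ∸ at ds i ≡ at ds j
Antipalindrome-at {ds} ds≤1 h {i} {j} len = complement (at≤1 i ds≤1) (begin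
    at ds i + at ds j                       ≡⟨ cong (λ k → at ds i + at ds k) (sym (m+n∸m≡n i j)) ⟩
    at ds i + at ds (suc (i + j) ∸ 1 ∸ i)   ≡⟨ cong (λ n → at ds i + at ds (n ∸ 1 ∸ i)) (sym len) ⟩
    at ds i + at ds (length ds ∸ 1 ∸ i)     ≡⟨ h i (subst (i <_) (sym len) (s≤s (m≤m+n i j))) ⟩
    1                                       ∎)
  where
  open ≡-Reasoning
  complement : ∀ {a b} → a ≤ 1 → a + b ≡ 1 → 1 ∸ a ≡ b
  complement z≤n       a+b≡1 = sym a+b≡1
  complement (s≤s z≤n) a+b≡1 = sym (suc-injective a+b≡1)

eval%8 : ∀ {ds} → All (_≤ 1) ds → eval ds % 8 ≡ eval3 (at ds 0) (at ds 1) (at ds 2)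
eval%8 {ds} ds≤1 = begin
    eval ds % 8                   ≡⟨ cong (_% 8) (trans (eval-low3 ds) (regroup a b c E)) ⟩
    (eval3 a b c + E * 8) % 8     ≡⟨ [m+kn]%n≡m%n (eval3 a b c) E 8 ⟩
    eval3 a b c % 8               ≡⟨ m<n⇒m%n≡m (eval3<8 (at≤1 0 ds≤1) (at≤1 1 ds≤1) (at≤1 2 ds≤1)) ⟩
    eval3 a b c                   ∎
  where
  open ≡-Reasoning
  a = at ds 0
  b = at ds 1
  c = at ds 2
  E = eval (drop 3 ds)
  regroup : ∀ a b c E → a + 2 * (b + 2 * (c + 2 * E)) ≡ a + 2 * (b + 2 * c) + E * 8
  regroup = solve-∀

eval-length3 : ∀ {ds} → length ds ≡ 3 → eval ds ≡ eval3 (at ds 0) (at ds 1) (at ds 2)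
eval-length3 {a ∷ b ∷ c ∷ []} refl = cong (λ x → a + 2 * (b + 2 * x)) (+-identityʳ c)

eval3-cong : ∀ {a b c a′ b′ c′} → a ≡ a′ → b ≡ b′ → c ≡ c′ → eval3 a b c ≡ eval3 a′ b′ c′
eval3-cong refl refl refl = refl

eval-top3 : ∀ {ds p} → length ds ≡ 3 + p →
  eval (drop p ds) ≡ eval3 (at ds p) (at ds (1 + p)) (at ds (2 + p))
eval-top3 {ds} {p} len =
  trans (eval-length3 {drop p ds} length-top)
        (eval3-cong (at-drop p ds 0) (at-drop p ds 1) (at-drop p ds 2))
  where
  length-top : length (drop p ds) ≡ 3
  length-top = trans (length-drop p ds) (trans (cong (_∸ p) len) (m+n∸n≡m 3 p))

leading-eval : ∀ {ds p} → All (_≤ 1) ds → Antipalindrome ds → length ds ≡ 3 + p →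
  leading (eval ds % 8) ≡ eval (drop p ds)
leading-eval {ds} {p} ds≤1 h len = begin
    leading (eval ds % 8)                     ≡⟨ cong leading (eval%8 ds≤1) ⟩
    leading (eval3 (at ds 0) (at ds 1) (at ds 2))
      ≡⟨ leading-eval3 (at≤1 0 ds≤1) (at≤1 1 ds≤1) (at≤1 2 ds≤1) ⟩
    eval3 (1 ∸ at ds 2) (1 ∸ at ds 1) (1 ∸ at ds 0)
      ≡⟨ eval3-cong (flip {2} {p} len) (flip {1} {1 + p} len) (flip {0} {2 + p} len) ⟩
    eval3 (at ds p) (at ds (1 + p)) (at ds (2 + p)) ≡⟨ sym (eval-top3 len) ⟩
    eval (drop p ds)                          ∎
  where
  open ≡-Reasoning
  flip : ∀ {i j} → length ds ≡ suc (i + j) → 1 ∸ at ds i ≡ at ds j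
  flip = Antipalindrome-at ds≤1 h

⌊_÷_⌋≡_ : ℕ → ℕ → ℕ → Set
⌊ X ÷ P ⌋≡ c = c * P ≤ X × X < suc c * P

eval÷2^p : ∀ p {ds} → All (_≤ 1) ds → ⌊ eval ds ÷ 2 ^ p ⌋≡ eval (drop p ds)
eval÷2^p p {ds} ds≤1 with eval-split p ds ds≤1
... | r , r<2^p , eval≡ rewrite eval≡ =
  ≤-trans (≤-reflexive (*-comm T (2 ^ p))) (m≤n+m (2 ^ p * T) r) ,
  subst (r + 2 ^ p * T <_) (cong (2 ^ p +_) (*-comm (2 ^ p) T)) (+-monoˡ-< (2 ^ p * T) r<2^p)
  where T = eval (drop p ds)

bits≤1 : ∀ X → All (_≤ 1) (bits X)
bits≤1 X = binLE-digits X X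

eval-bits : ∀ X → eval (bits X) ≡ X
eval-bits X = eval-binLE ≤-refl

2^length-bits≤ : ∀ {X} → 0 < X → 2 ^ length (bits X) ≤ 2 * X
2^length-bits≤ 0<X = 2^length-binLE≤ 0<X ≤-refl

leading-bounds : ∀ {X p} → Antipalindromic X → length (bits X) ≡ 3 + p →
  4 ≤ leading (X % 8) × ⌊ X ÷ 2 ^ p ⌋≡ leading (X % 8)
leading-bounds {X} {p} ap len = 4≤c , bounds
  where
  c = leading (X % 8)
  top≡c : eval (drop p (bits X)) ≡ c
  top≡c = trans (sym (leading-eval (bits≤1 X) (Antipalindromic⇒Antipalindrome ap) len))
                (cong (λ Y → leading (Y % 8)) (eval-bits X))
  bounds : ⌊ X ÷ 2 ^ p ⌋≡ c
  bounds = subst₂ (λ Y d → ⌊ Y ÷ 2 ^ p ⌋≡ d) (eval-bits X) top≡c (eval÷2^p p (bits≤1 X))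
  4*2^p≤X : 4 * 2 ^ p ≤ X
  4*2^p≤X = *-cancelˡ-≤ 2 (subst (_≤ 2 * X) (trans (cong (2 ^_) len) (2*[2*[2*x]]≡2*[4*x] (2 ^ p)))
                                              (2^length-bits≤ (proj₁ ap)))
    where
    2*[2*[2*x]]≡2*[4*x] : ∀ x → 2 * (2 * (2 * x)) ≡ 2 * (4 * x)
    2*[2*[2*x]]≡2*[4*x] = solve-∀
  4≤c : 4 ≤ c
  4≤c = s≤s⁻¹ (*-cancelʳ-< (2 ^ p) 4 (suc c) (≤-<-trans 4*2^p≤X (proj₂ bounds)))

Antipalindrome-length2⇒eval≡2 : ∀ {ds} → All (_≤ 1) ds → Antipalindrome ds → length ds ≡ 2 →
  2 ≤ eval ds → eval ds ≡ 2
Antipalindrome-length2⇒eval≡2 (z≤n       ∷ z≤n       ∷ []) h refl _ = ⊥-elim (0≢1+n (h 0 z<s))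
Antipalindrome-length2⇒eval≡2 (z≤n       ∷ s≤s z≤n   ∷ []) _ refl _ = refl
Antipalindrome-length2⇒eval≡2 (s≤s z≤n   ∷ z≤n       ∷ []) _ refl (s≤s ())
Antipalindrome-length2⇒eval≡2 (s≤s z≤n   ∷ s≤s z≤n   ∷ []) h refl _ = ⊥-elim (1+n≢n (h 0 z<s))

Antipalindromic-shape : ∀ {X} → Antipalindromic X →
  X ≡ 2 ⊎ ∃[ n ] length (bits X) ≡ 3 + (1 + (n + n))
Antipalindromic-shape {X} ap@(0<X , m , len , _) with m | trans (sym (length-reverse (bits X))) len
... | zero | len′ =
  ⊥-elim (<⇒≱ (subst₂ _<_ (eval-bits X) (cong (2 ^_) len′) (eval<2^length (bits≤1 X))) 0<X)
... | suc zero | len′ = inj₁ (trans (sym (eval-bits X))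
      (Antipalindrome-length2⇒eval≡2 (bits≤1 X) (Antipalindromic⇒Antipalindrome ap) len′ 2≤eval))
  where
  2≤eval : 2 ≤ eval (bits X)
  2≤eval = *-cancelˡ-≤ 2 (subst₂ (λ n Y → 2 ^ n ≤ 2 * Y) len′ (sym (eval-bits X)) (2^length-bits≤ 0<X))
... | suc (suc n) | len′ = inj₂ (n , trans len′ (2+n+[2+n]≡3+[1+[n+n]] n))
  where
  2+n+[2+n]≡3+[1+[n+n]] : ∀ n → suc (suc n) + suc (suc n) ≡ 3 + (1 + (n + n))
  2+n+[2+n]≡3+[1+[n+n]] = solve-∀

3[N*x]+x≡4*R*x : ∀ {N R} → 3 * N + 1 ≡ 4 * R → ∀ x → 3 * (N * x) + x ≡ 4 * R * x
3[N*x]+x≡4*R*x {N} {R} e x = trans (distrib N x) (cong (_* x) e)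
  where
  distrib : ∀ N x → 3 * (N * x) + x ≡ (3 * N + 1) * x
  distrib = solve-∀

-- Each refutation multiplies by 3 and substitutes 3N = 4R − 1, leaving a polynomial
-- inequality in R and c that fails in the stated range.
N*c≮[1+c]*R : ∀ {N R c} → 3 * N + 1 ≡ 4 * R → 4 ≤ R → 4 ≤ c → N * c ≮ suc c * R
N*c≮[1+c]*R {N} e (s≤s (s≤s (s≤s (s≤s {n = r} _)))) (s≤s (s≤s (s≤s (s≤s {n = c} _)))) lt =
  m+n≮m (3 * ((5 + c) * (4 + r)) + (4 + c)) (r + 3 * c + r * c) (begin-strict
    3 * ((5 + c) * (4 + r)) + (4 + c) + (r + 3 * c + r * c) ≡⟨ expand r c ⟩
    4 * (4 + r) * (4 + c)                                  ≡⟨ sym (3[N*x]+x≡4*R*x {N} {4 + r} e (4 + c)) ⟩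
    3 * (N * (4 + c)) + (4 + c)                            <⟨ +-monoˡ-< (4 + c) (*-monoʳ-< 3 lt) ⟩
    3 * ((5 + c) * (4 + r)) + (4 + c)                      ∎)
  where
  open ≤-Reasoning
  expand : ∀ r c → 3 * ((5 + c) * (4 + r)) + (4 + c) + (r + 3 * c + r * c) ≡ 4 * (4 + r) * (4 + c)
  expand = solve-∀

4*R*c≮N*[1+c] : ∀ {N R c} → 3 * N + 1 ≡ 4 * R → 0 < c → 4 * R * c ≮ N * suc c
4*R*c≮N*[1+c] {N} {R} e (s≤s {n = c} _) lt =
  m+n≮m (4 * R * (2 + c)) (4 * R + 8 * R * c) (begin-strict
    4 * R * (2 + c) + (4 * R + 8 * R * c) ≡⟨ expand R c ⟩
    3 * (4 * R * (1 + c))                 <⟨ *-monoʳ-< 3 lt ⟩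
    3 * (N * (2 + c))                     ≤⟨ m≤m+n _ (2 + c) ⟩
    3 * (N * (2 + c)) + (2 + c)           ≡⟨ 3[N*x]+x≡4*R*x {N} {R} e (2 + c) ⟩
    4 * R * (2 + c)                       ∎)
  where
  open ≤-Reasoning
  expand : ∀ R c → 4 * R * (2 + c) + (4 * R + 8 * R * c) ≡ 3 * (4 * R * (1 + c))
  expand = solve-∀

4*[N*c]≮[1+c]*R : ∀ {N R c} → 3 * N + 1 ≡ 4 * R → 0 < R → 0 < c → 4 * (N * c) ≮ suc c * R
4*[N*c]≮[1+c]*R {N} e (s≤s {n = r} _) (s≤s {n = c} _) lt =
  m+n≮m (3 * ((2 + c) * (1 + r)) + 4 * (1 + c)) (6 + 9 * c + 10 * r + 13 * r * c) (begin-strict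
    3 * ((2 + c) * (1 + r)) + 4 * (1 + c) + (6 + 9 * c + 10 * r + 13 * r * c) ≡⟨ expand r c ⟩
    4 * (4 * (1 + r) * (1 + c))                       ≡⟨ cong (4 *_) (sym (3[N*x]+x≡4*R*x {N} {1 + r} e (1 + c))) ⟩
    4 * (3 * (N * (1 + c)) + (1 + c))                 ≡⟨ regroup (N * (1 + c)) (1 + c) ⟩
    3 * (4 * (N * (1 + c))) + 4 * (1 + c)             <⟨ +-monoˡ-< (4 * (1 + c)) (*-monoʳ-< 3 lt) ⟩
    3 * ((2 + c) * (1 + r)) + 4 * (1 + c)             ∎)
  where
  open ≤-Reasoning
  expand : ∀ r c → 3 * ((2 + c) * (1 + r)) + 4 * (1 + c) + (6 + 9 * c + 10 * r + 13 * r * c)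
                   ≡ 4 * (4 * (1 + r) * (1 + c))
  expand = solve-∀
  regroup : ∀ x y → 4 * (3 * x + y) ≡ 3 * (4 * x) + 4 * y
  regroup = solve-∀

EqualOrFourApart : ℕ → ℕ → Set
EqualOrFourApart x y = x ≡ y ⊎ 4 * y ≤ x ⊎ 4 * x ≤ y

*4^-gap : ∀ k {a b} → a < b → 4 * (k * 4 ^ a) ≤ k * 4 ^ b
*4^-gap k {a} a<b = ≤-trans (≤-reflexive (swap k (4 ^ a))) (*-monoʳ-≤ k (^-monoʳ-≤ 4 a<b))
  where
  swap : ∀ k x → 4 * (k * x) ≡ k * (4 * x)
  swap = solve-∀

*4^-apart : ∀ k a b → EqualOrFourApart (k * 4 ^ a) (k * 4 ^ b)
*4^-apart k a b with <-cmp a b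
... | tri< a<b _ _ = inj₂ (inj₂ (*4^-gap k a<b))
... | tri≈ _ refl _ = inj₁ refl
... | tri> _ _ b<a = inj₂ (inj₁ (*4^-gap k b<a))

no-quotient-with-same-leading : ∀ {N R c P M A B} .{{_ : NonZero N}} →
  3 * N + 1 ≡ 4 * R → 4 ≤ R → 4 ≤ c → A ≡ N * B →
  ⌊ A ÷ P ⌋≡ c → ⌊ B ÷ M ⌋≡ c → EqualOrFourApart P (R * M) → ⊥
no-quotient-with-same-leading {N} {R} {c} {P} {M} {B = B} e 4≤R 4≤c refl
  (cP≤A , A<[1+c]P) (cM≤B , B<[1+c]M) = impossible
  where
  open ≤-Reasoning
  0<c = ≤-trans z<s 4≤c
  0<R = ≤-trans z<s 4≤R
  NcM≤A : N * c * M ≤ N * B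
  NcM≤A = ≤-trans (≤-reflexive (*-assoc N c M)) (*-monoʳ-≤ N cM≤B)
  A<N[1+c]M : N * B < N * suc c * M
  A<N[1+c]M = <-≤-trans (*-monoʳ-< N B<[1+c]M) (≤-reflexive (sym (*-assoc N (suc c) M)))
  regroup : ∀ R c M → 4 * R * c * M ≡ c * (4 * (R * M))
  regroup = solve-∀
  swap : ∀ k x → 4 * (k * x) ≡ k * (4 * x)
  swap = solve-∀
  impossible : EqualOrFourApart P (R * M) → ⊥
  impossible (inj₁ P≡RM) = N*c≮[1+c]*R {N} e 4≤R 4≤c (*-cancelʳ-< M _ _ (begin-strict
      N * c * M          ≤⟨ NcM≤A ⟩
      _                  <⟨ A<[1+c]P ⟩
      suc c * P          ≡⟨ cong (suc c *_) P≡RM ⟩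
      suc c * (R * M)    ≡⟨ sym (*-assoc (suc c) R M) ⟩
      suc c * R * M      ∎))
  impossible (inj₂ (inj₁ 4RM≤P)) = 4*R*c≮N*[1+c] {N} {R} e 0<c (*-cancelʳ-< M _ _ (begin-strict
      4 * R * c * M      ≡⟨ regroup R c M ⟩
      c * (4 * (R * M))  ≤⟨ *-monoʳ-≤ c 4RM≤P ⟩
      c * P              ≤⟨ cP≤A ⟩
      _                  <⟨ A<N[1+c]M ⟩
      N * suc c * M      ∎))
  impossible (inj₂ (inj₂ 4P≤RM)) = 4*[N*c]≮[1+c]*R {N} e 0<R 0<c (*-cancelʳ-< M _ _ (begin-strict
      4 * (N * c) * M    ≡⟨ *-assoc 4 (N * c) M ⟩
      4 * (N * c * M)    <⟨ *-monoʳ-< 4 (≤-<-trans NcM≤A A<[1+c]P) ⟩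
      4 * (suc c * P)    ≡⟨ swap (suc c) P ⟩
      suc c * (4 * P)    ≤⟨ *-monoʳ-≤ (suc c) 4P≤RM ⟩
      suc c * (R * M)    ≡⟨ sym (*-assoc (suc c) R M) ⟩
      suc c * R * M      ∎))

-- rep4 k = 1 + 4 + ⋯ + 4^(k−1), written (01)^k in base 2.
rep4 : ℕ → ℕ
rep4 zero    = 0
rep4 (suc k) = 4 * rep4 k + 1

3*rep4+1≡4^ : ∀ k → 3 * rep4 k + 1 ≡ 4 ^ k
3*rep4+1≡4^ zero    = refl
3*rep4+1≡4^ (suc k) = trans (step (rep4 k)) (cong (4 *_) (3*rep4+1≡4^ k))
  where
  step : ∀ x → 3 * (4 * x + 1) + 1 ≡ 4 * (3 * x + 1)
  step = solve-∀

k≤rep4 : ∀ k → k ≤ rep4 k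
k≤rep4 zero    = z≤n
k≤rep4 (suc k) = subst (suc k ≤_) (+-comm 1 (4 * rep4 k)) (s≤s (≤-trans (k≤rep4 k) (m≤n*m (rep4 k) 4)))

rep4[2+k]≡5+[2*rep4]*8 : ∀ k → rep4 (2 + k) ≡ 5 + 2 * rep4 k * 8
rep4[2+k]≡5+[2*rep4]*8 k = expand (rep4 k)
  where
  expand : ∀ x → 4 * (4 * x + 1) + 1 ≡ 5 + 2 * x * 8
  expand = solve-∀

alternating : ℕ → List ℕ
alternating zero    = []
alternating (suc k) = 0 ∷ 1 ∷ alternating k

binLE-cons : ∀ {f d n} → d ≤ 1 → 0 < d + n * 2 → binLE-fuel (suc f) (d + n * 2) ≡ d ∷ binLE-fuel f n
binLE-cons {f} {n = suc n} z≤n _ = cong₂ _∷_ (m*n%n≡0 (suc n) 2) (cong (binLE-fuel f) (m*n/n≡m (suc n) 2))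
binLE-cons {f} {n = n} (s≤s z≤n) _ =
  cong₂ _∷_ ([m+kn]%n≡m%n 1 n 2)
            (cong (binLE-fuel f) (trans (+-distrib-/-∣ʳ 1 {d = 2} (divides-refl n)) (m*n/n≡m n 2)))

binLE-alternating : ∀ k f → binLE-fuel (rep4 k * 2 + f) (rep4 k * 2) ≡ alternating k
binLE-alternating zero    f = binLE-0 f
binLE-alternating (suc k) f = begin
    binLE-fuel (rep4 (suc k) * 2 + f) (rep4 (suc k) * 2)
      ≡⟨ cong₂ binLE-fuel (fuel≡ r f) (value≡ r) ⟩
    binLE-fuel (2 + (r * 2 + (r * 6 + f))) (0 + (1 + r * 2 * 2) * 2)
      ≡⟨ binLE-cons {n = 1 + r * 2 * 2} z≤n z<s ⟩
    0 ∷ binLE-fuel (1 + (r * 2 + (r * 6 + f))) (1 + r * 2 * 2)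
      ≡⟨ cong (0 ∷_) (binLE-cons {n = r * 2} (s≤s z≤n) z<s) ⟩
    0 ∷ 1 ∷ binLE-fuel (r * 2 + (r * 6 + f)) (r * 2)
      ≡⟨ cong (λ ds → 0 ∷ 1 ∷ ds) (binLE-alternating k (r * 6 + f)) ⟩
    0 ∷ 1 ∷ alternating k ∎
  where
  open ≡-Reasoning
  r = rep4 k
  fuel≡ : ∀ r f → (4 * r + 1) * 2 + f ≡ 2 + (r * 2 + (r * 6 + f))
  fuel≡ = solve-∀
  value≡ : ∀ r → (4 * r + 1) * 2 ≡ 0 + (1 + r * 2 * 2) * 2
  value≡ = solve-∀

bits-rep4*2 : ∀ k → bits (rep4 k * 2) ≡ alternating k
bits-rep4*2 k = subst (λ f → binLE-fuel f (rep4 k * 2) ≡ alternating k) (+-identityʳ _) (binLE-alternating k 0)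

length-alternating : ∀ k → length (alternating k) ≡ k + k
length-alternating zero    = refl
length-alternating (suc k) = cong suc (trans (cong suc (length-alternating k)) (sym (+-suc k k)))

at-alternating : ∀ k {i} → i < length (alternating k) → at (alternating k) i ≡ i % 2
at-alternating (suc k) {zero}        _               = refl
at-alternating (suc k) {suc zero}    _               = refl
at-alternating (suc k) {suc (suc i)} (s≤s (s≤s i<n)) = at-alternating k i<n

m+m≡m*2 : ∀ m → m + m ≡ m * 2
m+m≡m*2 = solve-∀

[m+m]%2≡0 : ∀ m → (m + m) % 2 ≡ 0
[m+m]%2≡0 m = trans (cong (_% 2) (m+m≡m*2 m)) (m*n%n≡0 m 2)

[1+m+m]%2≡1 : ∀ m → suc (m + m) % 2 ≡ 1
[1+m+m]%2≡1 m = trans (cong (λ x → suc x % 2) (m+m≡m*2 m)) ([m+kn]%n≡m%n 1 m 2)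

%2+%2≡1 : ∀ {i j} m → i + j ≡ suc (m + m) → i % 2 + j % 2 ≡ 1
%2+%2≡1 {zero}        m       refl = [1+m+m]%2≡1 m
%2+%2≡1 {suc zero}    m       e    = cong suc (trans (cong (_% 2) (suc-injective e)) ([m+m]%2≡0 m))
%2+%2≡1 {suc (suc i)} (suc m) e    = %2+%2≡1 {i} m (trans (suc-injective (suc-injective e)) (+-suc m m))

alternating-Antipalindrome : ∀ k → Antipalindrome (alternating k)
alternating-Antipalindrome zero    i ()
alternating-Antipalindrome (suc k) i i<L = begin
    at l i + at l j  ≡⟨ cong₂ _+_ (at-alternating (suc k) i<L) (at-alternating (suc k) (mirror< i<L)) ⟩
    i % 2 + j % 2    ≡⟨ %2+%2≡1 {i} {j} k i+j≡1+2k ⟩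
    1                ∎
  where
  open ≡-Reasoning
  l = alternating (suc k)
  j = length l ∸ 1 ∸ i
  i+j≡1+2k : i + j ≡ suc (k + k)
  i+j≡1+2k = trans (m+[n∸m]≡n (s≤s⁻¹ i<L)) (cong suc (length-alternating k))

Antipalindromic-rep4*2 : ∀ k → Antipalindromic (rep4 (suc k) * 2)
Antipalindromic-rep4*2 k = Antipalindrome⇒Antipalindromic {m = suc k} 0<X
  (trans (cong length (bits-rep4*2 (suc k))) (length-alternating (suc k)))
  (subst Antipalindrome (sym (bits-rep4*2 (suc k))) (alternating-Antipalindrome (suc k)))
  where
  0<X : 0 < rep4 (suc k) * 2
  0<X = ≤-trans z<s (*-monoˡ-≤ 2 (m≤n+m 1 (4 * rep4 k)))

2^[1+[n+n]]≡2*4^n : ∀ n → 2 ^ (1 + (n + n)) ≡ 2 * 4 ^ n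
2^[1+[n+n]]≡2*4^n n =
  cong (2 *_) (trans (cong (λ m → 2 ^ (n + m)) (sym (+-identityʳ n))) (sym (^-*-assoc 2 2 n)))

4^s*[2*4^m]≡2*4^[s+m] : ∀ s m → 4 ^ s * (2 * 4 ^ m) ≡ 2 * 4 ^ (s + m)
4^s*[2*4^m]≡2*4^[s+m] s m = trans (swap (4 ^ s) (4 ^ m)) (cong (2 *_) (sym (^-distribˡ-+-* 4 s m)))
  where
  swap : ∀ x y → x * (2 * y) ≡ 2 * (x * y)
  swap = solve-∀

module _ (j : ℕ) where

  private
    N = rep4 (2 + j)
    R = 4 ^ (1 + j)

  5≤N : 5 ≤ N
  5≤N = subst (5 ≤_) (sym (rep4[2+k]≡5+[2*rep4]*8 j)) (m≤m+n 5 _)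

  leading-quotient : ∀ {A B} → A ≡ N * B → 4 ≤ leading (B % 8) → leading (A % 8) ≡ leading (B % 8)
  leading-quotient {B = B} refl 4≤c = begin
      leading (N * B % 8)
        ≡⟨ cong leading (%-distribˡ-* N B 8) ⟩
      leading (N % 8 * (B % 8) % 8)
        ≡⟨ cong (λ x → leading (x % 8 * (B % 8) % 8)) (rep4[2+k]≡5+[2*rep4]*8 j) ⟩
      leading ((5 + 2 * rep4 j * 8) % 8 * (B % 8) % 8)
        ≡⟨ cong (λ x → leading (x * (B % 8) % 8)) ([m+kn]%n≡m%n 5 (2 * rep4 j) 8) ⟩
      leading (5 * (B % 8) % 8)
        ≡⟨ leading-5* (B % 8) 4≤c ⟩
      leading (B % 8) ∎
    where open ≡-Reasoning

  long-quotient-impossible : ∀ {A B n m} → Antipalindromic A → Antipalindromic B → A ≡ N * B →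
    length (bits A) ≡ 3 + (1 + (n + n)) → length (bits B) ≡ 3 + (1 + (m + m)) → ⊥
  long-quotient-impossible {A} {B} {n} {m} apA apB A≡NB lenA lenB =
    no-quotient-with-same-leading {{>-nonZero (≤-trans z<s 5≤N)}}
      (3*rep4+1≡4^ (2 + j)) (*-monoʳ-≤ 4 (m^n>0 4 j)) 4≤c A≡NB A÷P B÷M apart
    where
    P = 2 ^ (1 + (n + n))
    M = 2 ^ (1 + (m + m))
    4≤c = proj₁ (leading-bounds apB lenB)
    B÷M = proj₂ (leading-bounds apB lenB)
    A÷P : ⌊ A ÷ P ⌋≡ leading (B % 8)
    A÷P = subst (⌊ A ÷ P ⌋≡_) (leading-quotient A≡NB 4≤c) (proj₂ (leading-bounds apA lenA))
    apart : EqualOrFourApart P (R * M)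
    apart = subst₂ EqualOrFourApart (sym (2^[1+[n+n]]≡2*4^n n))
      (trans (sym (4^s*[2*4^m]≡2*4^[s+m] (1 + j) m)) (cong (R *_) (sym (2^[1+[n+n]]≡2*4^n m))))
      (*4^-apart 2 n (1 + j + m))

  quotient-divisor≡2 : ∀ {A B} → Antipalindromic A → Antipalindromic B → A ≡ N * B → B ≡ 2
  quotient-divisor≡2 {A} {B} apA apB A≡NB with Antipalindromic-shape apA | Antipalindromic-shape apB
  ... | _               | inj₁ B≡2        = B≡2
  ... | inj₁ A≡2        | inj₂ _          = ⊥-elim (<⇒≱ {2} {5} (s≤s (s≤s (s≤s z≤n))) (subst (5 ≤_) A≡2 5≤A))
    where
    5≤A : 5 ≤ A
    5≤A = ≤-trans 5≤N (subst (N ≤_) (sym A≡NB) (m≤m*n N B {{>-nonZero (proj₁ apB)}}))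
  ... | inj₂ (n , lenA) | inj₂ (m , lenB) =
    ⊥-elim (long-quotient-impossible {n = n} {m} apA apB A≡NB lenA lenB)

theorem22 : (k : ℕ) → Σ ℕ λ N → (k ≤ N) × (0 < N) ×
    Σ ℕ λ A → Σ ℕ λ B → Antipalindromic A × Antipalindromic B × (A ≡ N * B) ×
    ((A′ B′ : ℕ) → Antipalindromic A′ → Antipalindromic B′ → A′ ≡ N * B′ →
    (A′ ≡ A) × (B′ ≡ B))
theorem22 k = N , ≤-trans (m≤n+m k 2) (k≤rep4 (2 + k)) , ≤-trans z<s (5≤N k) ,
  N * 2 , 2 , Antipalindromic-rep4*2 (suc k) , Antipalindromic-rep4*2 0 , refl , unique
  where
  N = rep4 (2 + k)
  unique : (A′ B′ : ℕ) → Antipalindromic A′ → Antipalindromic B′ → A′ ≡ N * B′ → (A′ ≡ N * 2) × (B′ ≡ 2)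
  unique A′ B′ apA apB A≡NB = trans A≡NB (cong (N *_) B≡2) , B≡2
    where
    B≡2 = quotient-divisor≡2 k apA apB A≡NB
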